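{- (1) There is a Boolean algebra (with $\neg$ its complement) equipped with a multiplicative unary operation $\Box$ and an additive unary operation $\Diamond$ satisfying $\Diamond\neg a\leq\neg\Box a$ and $\Box\neg a\leq\neg\Diamond a$ for all $a$, but not satisfying $\neg\Diamond a\leq\Box\neg a$ for all $a$; i.e., the latter inequality is independent of the former two over such algebras. (2) There is a Heyting algebra (with $\neg$ its pseudocomplement) equipped with a multiplicative $\Box$ and an additive $\Diamond$ satisfying $\Diamond\neg a\leq\neg\Box a$, $\Box\neg a\leq\neg\Diamond a$ and $\neg\Box a\leq\Diamond\neg a$ for all $a$, but not satisfying $\neg\Diamond a\leq\Box\neg a$ for all $a$.
   Context: Multiplicative: $\Box$ preserves finite meets (including $\Box1=1$); additive: $\Diamond$ preserves finite joins (including $\Diamond0=0$). In a Heyting algebra, $\neg a=a\to0$. -}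

module Defs where

open import Level using (Level; _⊔_)
open import Data.Product using (Σ; _×_)
open import Relation.Nullary using () renaming (¬_ to Not)
open import Relation.Binary.Lattice.Bundles using (HeytingAlgebra; BooleanAlgebra)

module _ {c ℓ₁ ℓ₂ : Level} (H : HeytingAlgebra c ℓ₁ ℓ₂) where
  open HeytingAlgebra H

  Multiplicative : (Carrier → Carrier) → Set (c ⊔ ℓ₁)
  Multiplicative f = (f ⊤ ≈ ⊤) × (∀ a b → f (a ∧ b) ≈ f a ∧ f b)

  Additive : (Carrier → Carrier) → Set (c ⊔ ℓ₁)
  Additive f = (f ⊥ ≈ ⊥) × (∀ a b → f (a ∨ b) ≈ f a ∨ f b)

  neg : Carrier → Carrier
  neg a = a ⇨ ⊥

module _ {c ℓ₁ ℓ₂ : Level} (B : BooleanAlgebra c ℓ₁ ℓ₂) where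
  open BooleanAlgebra B

  BooleanWitness : Set (c ⊔ ℓ₁ ⊔ ℓ₂)
  BooleanWitness =
    Σ (Carrier → Carrier) λ □ → Σ (Carrier → Carrier) λ ◇ →
      Multiplicative heytingAlgebra □ × Additive heytingAlgebra ◇ ×
      (∀ a → ◇ (¬ a) ≤ ¬ (□ a)) ×
      (∀ a → □ (¬ a) ≤ ¬ (◇ a)) ×
      Not (∀ a → ¬ (◇ a) ≤ □ (¬ a))

module _ {c ℓ₁ ℓ₂ : Level} (H : HeytingAlgebra c ℓ₁ ℓ₂) where
  open HeytingAlgebra H

  HeytingWitness : Set (c ⊔ ℓ₁ ⊔ ℓ₂)
  HeytingWitness =
    Σ (Carrier → Carrier) λ □ → Σ (Carrier → Carrier) λ ◇ →
      Multiplicative H □ × Additive H ◇ ×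
      (∀ a → ◇ (neg H a) ≤ neg H (□ a)) ×
      (∀ a → □ (neg H a) ≤ neg H (◇ a)) ×
      (∀ a → neg H (□ a) ≤ ◇ (neg H a)) ×
      Not (∀ a → neg H (◇ a) ≤ □ (neg H a))

{-# OPTIONS --safe #-}

-- In both algebras □ is the identity. On the two-element Boolean algebra take ◇ to be
-- constantly 0: then ¬◇1 = 1 while □¬1 = 0. On the three-element chain 0 < m < 1 let
-- ◇ send 1 to 1 and everything else to 0. It is monotone, hence preserves the joins (maxima)
-- of the chain; it is deflationary, so the first two inequalities follow from ¬ being
-- antitone; and it fixes 0 and 1, the only values of ¬ on a chain, which gives ¬□a ≤ ◇¬a.
-- But ¬◇m = ¬0 = 1 while □¬m = 0.

module Submission where

open import Defs
open import Level using (Level; 0ℓ)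
open import Algebra.Core using (Op₁; Op₂)
import Algebra.Construct.NaturalChoice.Max as Max
import Algebra.Construct.NaturalChoice.Min as Min
open import Data.Bool.Base using (true; false; not)
import Data.Bool.Properties as Bool
open import Data.Fin.Base using (zero; suc)
import Data.Fin.Properties as Fin
open import Data.Nat.Base using (z≤n; s≤s)
open import Data.Product.Base using (Σ; _×_; _,_)
open import Data.Sum.Base using ([_,_]′)
open import Function.Base using (id; const)
open import Relation.Binary.Bundles using (DecTotalOrder)
open import Relation.Binary.Core using (_Preserves_⟶_)
open import Relation.Binary.Definitions using (Maximum; Minimum)
open import Relation.Binary.Lattice.Bundles using (HeytingAlgebra; BooleanAlgebra)
open import Relation.Binary.Lattice.Definitions using (Exponential)
open import Relation.Binary.Lattice.Structures using (IsHeytingAlgebra)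
import Relation.Binary.Lattice.Properties.HeytingAlgebra as HeytingAlgebraProperties
import Relation.Binary.Lattice.Properties.JoinSemilattice as JoinSemilatticeProperties
open import Relation.Binary.PropositionalEquality using (_≡_)
import Relation.Binary.PropositionalEquality as ≡
import Relation.Binary.Reasoning.PartialOrder as PosetReasoning
open import Relation.Nullary using (yes; no; contradiction)
import Relation.Nullary as Nullary

private
  variable
    c ℓ₁ ℓ₂ : Level

module _ (H : HeytingAlgebra c ℓ₁ ℓ₂) where
  open HeytingAlgebra H

  id-multiplicative : Multiplicative H id
  id-multiplicative = Eq.refl , λ _ _ → Eq.refl

  const-⊥-additive : Additive H (const ⊥)
  const-⊥-additive = Eq.refl , λ _ _ → Eq.sym (∨-idempotent ⊥)
    where open JoinSemilatticeProperties joinSemilattice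

  booleanAlgebra : (¬_ : Op₁ Carrier) → (∀ x y → x ⇨ y ≈ (¬ x) ∨ y) →
                   BooleanAlgebra c ℓ₁ ℓ₂
  booleanAlgebra ¬_ ⇨≈¬∨ = record
    { ¬_               = ¬_
    ; isBooleanAlgebra = record
      { isHeytingAlgebra = record
        { isBoundedLattice = isBoundedLattice
        ; exponential      = λ w x y →
            (λ w∧x≤y → trans (transpose-⇨ w∧x≤y) (reflexive (⇨≈¬∨ x y)))
          , (λ w≤¬x∨y → transpose-∧ (trans w≤¬x∨y (reflexive (Eq.sym (⇨≈¬∨ x y)))))
        }
      }
    }

module _ (B : BooleanAlgebra c ℓ₁ ℓ₂) where
  open BooleanAlgebra B

  ⊤≤¬⊥ : ⊤ ≤ ¬ ⊥
  ⊤≤¬⊥ = trans (transpose-⇨ (x∧y≤y ⊤ ⊥)) (∨-least refl (minimum (¬ ⊥)))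

  ¬⊤≤⊥ : ¬ ⊤ ≤ ⊥
  ¬⊤≤⊥ = trans (∧-greatest refl (maximum (¬ ⊤))) (transpose-∧ (x≤x∨y (¬ ⊤) ⊥))

  booleanWitness : Nullary.¬ (⊤ ≤ ⊥) → BooleanWitness B
  booleanWitness ⊤≰⊥ =
    id , const ⊥ , id-multiplicative heytingAlgebra , const-⊥-additive heytingAlgebra ,
    (λ a → minimum (¬ a)) ,
    (λ a → trans (maximum (¬ a)) ⊤≤¬⊥) ,
    λ ¬◇≤□¬ → ⊤≰⊥ (trans ⊤≤¬⊥ (trans (¬◇≤□¬ ⊤) ¬⊤≤⊥))

module BoundedChain (O : DecTotalOrder c ℓ₁ ℓ₂) {⊤ ⊥ : DecTotalOrder.Carrier O}
                    (maximum : Maximum (DecTotalOrder._≤_ O) ⊤)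
                    (minimum : Minimum (DecTotalOrder._≤_ O) ⊥) where
  open DecTotalOrder O
  open Min totalOrder using (_⊓_; x⊓y≤x; x⊓y≤y; ⊓-glb)
  open Max totalOrder using (_⊔_; x≤x⊔y; x≤y⊔x; ⊔-lub; mono-≤-distrib-⊔)

  infixr 5 _⇨_
  _⇨_ : Op₂ Carrier
  x ⇨ y with x ≤? y
  ... | yes _ = ⊤
  ... | no  _ = y

  ⇨-exponential : Exponential _≤_ _⊓_ _⇨_
  ⇨-exponential w x y = transpose-⇨ , transpose-⊓
    where
    transpose-⇨ : w ⊓ x ≤ y → w ≤ x ⇨ y
    transpose-⇨ w⊓x≤y with x ≤? y
    ... | yes _   = maximum w
    ... | no  x≰y = [ (λ w≤x → trans (⊓-glb refl w≤x) w⊓x≤y)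
                    , (λ x≤w → contradiction (trans (⊓-glb x≤w refl) w⊓x≤y) x≰y)
                    ]′ (total w x)

    transpose-⊓ : w ≤ x ⇨ y → w ⊓ x ≤ y
    transpose-⊓ w≤x⇨y with x ≤? y
    ... | yes x≤y = trans (x⊓y≤y w x) x≤y
    ... | no  _   = trans (x⊓y≤x w x) w≤x⇨y

  isHeytingAlgebra : IsHeytingAlgebra _≈_ _≤_ _⊔_ _⊓_ _⇨_ ⊤ ⊥
  isHeytingAlgebra = record
    { isBoundedLattice = record
      { isLattice = record
        { isPartialOrder = isPartialOrder
        ; supremum       = λ x y → x≤x⊔y x y , x≤y⊔x x y , λ _ → ⊔-lub
        ; infimum        = λ x y → x⊓y≤x x y , x⊓y≤y x y , λ _ → ⊓-glb
        }
      ; maximum = maximum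
      ; minimum = minimum
      }
    ; exponential = ⇨-exponential
    }

  heytingAlgebra : HeytingAlgebra c ℓ₁ ℓ₂
  heytingAlgebra = record { isHeytingAlgebra = isHeytingAlgebra }

  open HeytingAlgebraProperties heytingAlgebra using (⇨ˡ-contravariant)

  x≤y⇒⊤≤x⇨y : ∀ {x y} → x ≤ y → ⊤ ≤ x ⇨ y
  x≤y⇒⊤≤x⇨y {x} {y} x≤y with x ≤? y
  ... | yes _   = refl
  ... | no  x≰y = contradiction x≤y x≰y

  x≰y⇒x⇨y≤y : ∀ {x y} → Nullary.¬ (x ≤ y) → x ⇨ y ≤ y
  x≰y⇒x⇨y≤y {x} {y} x≰y with x ≤? y
  ... | yes x≤y = contradiction x≤y x≰y
  ... | no  _   = refl

  ⊤-indicator : Op₁ Carrier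
  ⊤-indicator x with ⊤ ≤? x
  ... | yes _ = ⊤
  ... | no  _ = ⊥

  ⊤-indicator-deflationary : ∀ x → ⊤-indicator x ≤ x
  ⊤-indicator-deflationary x with ⊤ ≤? x
  ... | yes ⊤≤x = ⊤≤x
  ... | no  _   = minimum x

  ⊤-indicator-monotone : ⊤-indicator Preserves _≤_ ⟶ _≤_
  ⊤-indicator-monotone {x} {y} x≤y with ⊤ ≤? x | ⊤ ≤? y
  ... | yes _   | yes _   = refl
  ... | yes ⊤≤x | no  ⊤≰y = contradiction (trans ⊤≤x x≤y) ⊤≰y
  ... | no  _   | _       = minimum _

  ⊤-indicator-⊤ : ⊤ ≤ ⊤-indicator ⊤
  ⊤-indicator-⊤ with ⊤ ≤? ⊤
  ... | yes _   = refl
  ... | no  ⊤≰⊤ = contradiction refl ⊤≰⊤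

  ⊤≰x⇒⊤-indicator≤⊥ : ∀ {x} → Nullary.¬ (⊤ ≤ x) → ⊤-indicator x ≤ ⊥
  ⊤≰x⇒⊤-indicator≤⊥ {x} ⊤≰x with ⊤ ≤? x
  ... | yes ⊤≤x = contradiction ⊤≤x ⊤≰x
  ... | no  _   = refl

  ⊤-indicator-additive : Nullary.¬ (⊤ ≤ ⊥) → Additive heytingAlgebra ⊤-indicator
  ⊤-indicator-additive ⊤≰⊥ =
    antisym (⊤≰x⇒⊤-indicator≤⊥ ⊤≰⊥) (minimum _) ,
    mono-≤-distrib-⊔ ⊤-indicator-cong ⊤-indicator-monotone
    where
    ⊤-indicator-cong : ⊤-indicator Preserves _≈_ ⟶ _≈_
    ⊤-indicator-cong x≈y = antisym (⊤-indicator-monotone (reflexive x≈y))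
                                   (⊤-indicator-monotone (reflexive (Eq.sym x≈y)))

  ⊤-indicator-fixes-negations : ∀ x → x ⇨ ⊥ ≤ ⊤-indicator (x ⇨ ⊥)
  ⊤-indicator-fixes-negations x with x ≤? ⊥
  ... | yes _ = ⊤-indicator-⊤
  ... | no  _ = minimum _

  heytingWitness : ∀ m → Nullary.¬ (m ≤ ⊥) → Nullary.¬ (⊤ ≤ m) → HeytingWitness heytingAlgebra
  heytingWitness m m≰⊥ ⊤≰m =
    id , ⊤-indicator , id-multiplicative heytingAlgebra , ⊤-indicator-additive ⊤≰⊥ ,
    (λ a → ⊤-indicator-deflationary (a ⇨ ⊥)) ,
    (λ a → ⇨ˡ-contravariant (⊤-indicator-deflationary a)) ,
    ⊤-indicator-fixes-negations ,
    λ ¬◇≤□¬ → ⊤≰m (begin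
      ⊤                   ≤⟨ x≤y⇒⊤≤x⇨y (⊤≰x⇒⊤-indicator≤⊥ ⊤≰m) ⟩
      ⊤-indicator m ⇨ ⊥   ≤⟨ ¬◇≤□¬ m ⟩
      m ⇨ ⊥               ≤⟨ x≰y⇒x⇨y≤y m≰⊥ ⟩
      ⊥                   ≤⟨ minimum m ⟩
      m                   ∎)
    where
    open PosetReasoning poset
    ⊤≰⊥ : Nullary.¬ (⊤ ≤ ⊥)
    ⊤≰⊥ ⊤≤⊥ = ⊤≰m (trans ⊤≤⊥ (minimum m))

module Two = BoundedChain Bool.≤-decTotalOrder Bool.≤-maximum Bool.≤-minimum

two : BooleanAlgebra 0ℓ 0ℓ 0ℓ
two = booleanAlgebra Two.heytingAlgebra not ⇨≡not∨
  where
  open HeytingAlgebra Two.heytingAlgebra using (_⇨_; _∨_)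

  ⇨≡not∨ : ∀ x y → x ⇨ y ≡ not x ∨ y
  ⇨≡not∨ false false = ≡.refl
  ⇨≡not∨ false true  = ≡.refl
  ⇨≡not∨ true  false = ≡.refl
  ⇨≡not∨ true  true  = ≡.refl

module Three = BoundedChain (Fin.≤-decTotalOrder 3) Fin.≤fromℕ (λ _ → z≤n)

proposition4p4 : Σ (BooleanAlgebra 0ℓ 0ℓ 0ℓ) BooleanWitness
                 × Σ (HeytingAlgebra 0ℓ 0ℓ 0ℓ) HeytingWitness
proposition4p4 =
  (two , booleanWitness two λ ()) ,
  (Three.heytingAlgebra , Three.heytingWitness (suc zero) (λ ()) λ { (s≤s ()) })
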